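{- Let $\mathcal B\subseteq\mathcal P([n])$ be a family with $|\mathcal B|=m$. Then $\|\mathcal B\|\le\|\mathcal I(m)\|+\mathrm{def}(\mathcal B)$.
   Context: For a finite set $B$, $\delta B=\{B\setminus\{i\}:i\in B\}$. The deficiency of a finite family $\mathcal B$ of finite sets is $\mathrm{def}(\mathcal B)=\sum_{B\in\mathcal B}|\delta B\setminus\mathcal B|$. $\|\mathcal F\|=\sum_{F\in\mathcal F}|F|$. The colex order: $A<B$ iff $\max(A\triangle B)\in B$; $\mathcal I(m)$ is the family of the first $m$ finite sets of positive integers in this order. -}

module Defs where

open import Data.Bool using (Bool; true; false; _∧_; _∨_; not; if_then_else_)
open import Data.Nat using (ℕ; zero; suc; _+_; _<ᵇ_)
open import Data.Fin using (Fin)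
open import Data.Fin.Subset using (Subset; ∣_∣; _-_; inside; outside)
open import Data.Vec using (Vec; []; _∷_; lookup)
import Data.Vec.Properties as VecP
open import Data.Bool.Properties using () renaming (_≟_ to _≟B_)
open import Data.List using (List; []; _∷_; map; filter; length; allFin; concatMap)
import Data.List.Membership.DecPropositional as DecMem
open import Data.Nat.ListAction using (sum)
open import Relation.Nullary using (Dec; yes; no; ¬?)
open import Relation.Nullary.Decidable using (does)

-- Finite families of subsets of [n] = Fin n are lists of Subset n
-- (a Subset n is a characteristic vector; position i stands for element i+1).
Family : ℕ → Set
Family n = List (Subset n)

_∈F?_ : ∀ {n} (B : Subset n) (𝓑 : Family n) → Bool
B ∈F? 𝓑 = does (DecMem._∈?_ (VecP.≡-dec _≟B_) B 𝓑)

-- |δB ∖ 𝓑| : number of i ∈ B with B∖{i} ∉ 𝓑 (the sets B∖{i} are pairwise distinct).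
δ-missing : ∀ {n} → Family n → Subset n → ℕ
δ-missing {n} 𝓑 B =
  length (filter (λ i → (lookup B i) ∧ not ((B - i) ∈F? 𝓑) Data.Bool.≟ true) (allFin n))
  where import Data.Bool

def : ∀ {n} → Family n → ℕ
def 𝓑 = sum (map (δ-missing 𝓑) 𝓑)

‖_‖ : ∀ {n} → Family n → ℕ
‖ 𝓕 ‖ = sum (map ∣_∣ 𝓕)

-- Colex order on subsets of [n]: A < B iff max(A △ B) ∈ B.
-- Recursion from the largest element (the last vector entry) downwards:
-- compare the larger elements first; if they agree, decide at the smallest one.
_<colex_ : ∀ {n} → Subset n → Subset n → Bool
[] <colex [] = false
(a ∷ as) <colex (b ∷ bs) =
  (as <colex bs) ∨ (eqV as bs ∧ (not a ∧ b))
  where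
  eqV : ∀ {k} → Subset k → Subset k → Bool
  eqV xs ys = does (VecP.≡-dec _≟B_ xs ys)

allSubsets : (k : ℕ) → List (Subset k)
allSubsets zero = [] ∷ []
allSubsets (suc k) = concatMap (λ s → (outside ∷ s) ∷ (inside ∷ s) ∷ []) (allSubsets k)

colexRank : ∀ {k} → Subset k → ℕ
colexRank {k} A = length (filter (λ C → C <colex A Data.Bool.≟ true) (allSubsets k))
  where import Data.Bool

-- I(m) = the first m finite sets of positive integers in colex order.
-- Every such set is a subset of [m] (any set with an element > m is preceded
-- by all 2^m ≥ m subsets of [m]), and all colex-predecessors of a subset of
-- [m] are subsets of [m]; so I(m) = {A ⊆ [m] : A has < m colex predecessors}.
I : (m : ℕ) → Family m
I m = filter (λ A → (colexRank A <ᵇ m) Data.Bool.≟ true) (allSubsets m)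
  where import Data.Bool

module Submission where

-- Read a subset s of [k] as the binary number  value s  whose least significant
-- bit is the membership of element 1.  The colex order is then the numeric order
-- of these values, so I(m) is the set of subsets of [m] with value below m, and
-- ‖I(m)‖ = h m m, where  h k m  is the total size of the m numerically smallest
-- subsets of [k].  Splitting those subsets by element 1 gives the recursion
--   h (k+1) m = h k ⌈m/2⌉ + h k ⌊m/2⌋ + ⌊m/2⌋,
-- which we take as the definition of h.  Its key property is superadditivity:
--   h k a + h k b + c ≤ h k (a + b)   whenever c ≤ a, c ≤ b and a + b ≤ 2^k.
-- The theorem then follows by induction on n: split 𝓑 by element 1 into the
-- fibers 𝓑₀ (members avoiding 1) and 𝓑₁ (members containing 1, with 1 removed);
--   ‖𝓑‖ = ‖𝓑₀‖ + ‖𝓑₁‖ + |𝓑₁|   and   def 𝓑 = def 𝓑₀ + def 𝓑₁ + |𝓑₁ ∖ 𝓑₀|,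
-- while |𝓑₁| − |𝓑₁ ∖ 𝓑₀| = |𝓑₁ ∩ 𝓑₀| ≤ min(|𝓑₀|, |𝓑₁|), so superadditivity
-- closes the induction step.

open import Defs
open import Data.Bool using (Bool; true; false; _∧_; _∨_; not; if_then_else_)
import Data.Bool as Bool
open import Data.Bool.Properties using () renaming (_≟_ to _≟B_)
open import Data.Nat using (ℕ; zero; suc; _+_; _≤_; _<_; z≤n; s≤s; _<ᵇ_; _≡ᵇ_; ⌊_/2⌋; ⌈_/2⌉)
open import Data.Nat.Properties
open import Data.Nat.Tactic.RingSolver using (solve-∀)
open import Data.Fin as Fin using (Fin)
open import Data.Fin.Subset using (Subset; ∣_∣; _-_)
open import Data.Fin.Subset.Properties using (p─⊥≡p)
open import Data.Vec using ([]; _∷_; lookup)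
import Data.Vec.Properties as Vec
open import Data.List using (List; []; _∷_; map; filter; length; tabulate; allFin; concatMap)
open import Data.List.Properties using (map-tabulate)
open import Data.List.Relation.Unary.All as All using (All; []; _∷_)
open import Data.List.Relation.Unary.AllPairs using ([]; _∷_)
open import Data.List.Relation.Unary.Unique.Propositional using (Unique)
open import Data.Nat.ListAction using (sum)
open import Data.Empty using (⊥-elim)
open import Function using (id; _∘_)
open import Relation.Nullary using (does; yes; no; ¬_)
open import Relation.Binary.PropositionalEquality

-- Doubling, defined by recursion so that the parity view below computes.
double : ℕ → ℕ
double zero    = zero
double (suc n) = suc (suc (double n))

double≡+ : ∀ x → double x ≡ x + x
double≡+ zero    = refl
double≡+ (suc x) = cong suc (trans (cong suc (double≡+ x)) (sym (+-suc x x)))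

double-+ : ∀ x y → double x + double y ≡ double (x + y)
double-+ zero    y = refl
double-+ (suc x) y = cong (λ z → suc (suc z)) (double-+ x y)

double-mono : ∀ {a b} → a ≤ b → double a ≤ double b
double-mono z≤n     = z≤n
double-mono (s≤s p) = s≤s (s≤s (double-mono p))

double-≤⁻ : ∀ {a b} → double a ≤ double b → a ≤ b
double-≤⁻ {zero}              _                 = z≤n
double-≤⁻ {suc a} {suc b}     (s≤s (s≤s p))     = s≤s (double-≤⁻ p)

double-≤-suc⁻ : ∀ {a b} → double a ≤ suc (double b) → a ≤ b
double-≤-suc⁻ {zero}          _                 = z≤n
double-≤-suc⁻ {suc a} {suc b} (s≤s (s≤s p))     = s≤s (double-≤-suc⁻ p)
double-≤-suc⁻ {suc a} {zero}  (s≤s ())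

suc-double-≤⁻ : ∀ {a b} → suc (double a) ≤ double b → a < b
suc-double-≤⁻ {zero}  {suc b} _                 = s≤s z≤n
suc-double-≤⁻ {suc a} {suc b} (s≤s (s≤s p))     = s≤s (suc-double-≤⁻ p)

⌊double/2⌋ : ∀ x → ⌊ double x /2⌋ ≡ x
⌊double/2⌋ zero    = refl
⌊double/2⌋ (suc x) = cong suc (⌊double/2⌋ x)

⌈double/2⌉ : ∀ x → ⌈ double x /2⌉ ≡ x
⌈double/2⌉ zero    = refl
⌈double/2⌉ (suc x) = cong suc (⌈double/2⌉ x)

-- 2^k, written with double so that it unfolds along the recursion of h.
pow2 : ℕ → ℕ
pow2 zero    = 1
pow2 (suc k) = double (pow2 k)

-- n ≤ 2^n: this bounds the families I(m) and |𝓑| = m by 2^m.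
n≤pow2n : ∀ n → n ≤ pow2 n
n≤pow2n zero    = z≤n
n≤pow2n (suc n) = begin
  suc n                 ≤⟨ +-monoʳ-≤ 1 (n≤pow2n n) ⟩
  1 + pow2 n            ≤⟨ +-monoˡ-≤ (pow2 n) (1≤pow2 n) ⟩
  pow2 n + pow2 n       ≡⟨ sym (double≡+ (pow2 n)) ⟩
  double (pow2 n)       ∎
  where
  open ≤-Reasoning
  1≤pow2 : ∀ n → 1 ≤ pow2 n
  1≤pow2 zero    = s≤s z≤n
  1≤pow2 (suc n) = ≤-trans (1≤pow2 n) (subst (pow2 n ≤_) (sym (double≡+ (pow2 n))) (m≤m+n _ _))

⌈/2⌉-bound : ∀ {m p} → m ≤ double p → ⌈ m /2⌉ ≤ p
⌈/2⌉-bound {zero}        _             = z≤n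
⌈/2⌉-bound {suc zero}    {suc p} _     = s≤s z≤n
⌈/2⌉-bound {suc (suc m)} {suc p} (s≤s (s≤s q)) = s≤s (⌈/2⌉-bound q)

⌊/2⌋-bound : ∀ {m p} → m ≤ double p → ⌊ m /2⌋ ≤ p
⌊/2⌋-bound {m} q = ≤-trans (⌊n/2⌋≤⌈n/2⌉ m) (⌈/2⌉-bound q)

data Parity : ℕ → Set where
  even : ∀ x → Parity (double x)
  odd  : ∀ x → Parity (suc (double x))

parity : ∀ m → Parity m
parity zero = even zero
parity (suc m) with parity m
... | even x = odd x
... | odd x  = even (suc x)

-- h k m is the total size of the m numerically smallest subsets of [k]
-- (valid for m ≤ 2^k, see weightBelow≡h): among them ⌈m/2⌉ avoid element 1
-- and ⌊m/2⌋ contain it, each of the latter contributing one extra element.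
h : ℕ → ℕ → ℕ
h zero    m = 0
h (suc k) m = h k ⌈ m /2⌉ + h k ⌊ m /2⌋ + ⌊ m /2⌋

h-even : ∀ k x → h (suc k) (double x) ≡ h k x + h k x + x
h-even k x rewrite ⌈double/2⌉ x | ⌊double/2⌋ x = refl

h-odd : ∀ k x → h (suc k) (suc (double x)) ≡ h k (suc x) + h k x + x
h-odd k x rewrite ⌊double/2⌋ x | ⌈double/2⌉ x = refl

add-≤ : ∀ {l r p p′ q q′} e → l ≡ p + q + e → p ≤ p′ → q ≤ q′ → p′ + q′ + e ≡ r → l ≤ r
add-≤ e refl p≤p′ q≤q′ refl = +-monoˡ-≤ e (+-mono-≤ p≤p′ q≤q′)

OrderedSuperadditive : ℕ → Set
OrderedSuperadditive k = ∀ a b → a ≤ b → a + b ≤ pow2 k → h k a + h k b + a ≤ h k (a + b)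

Superadditive : ℕ → Set
Superadditive k = ∀ a b c → c ≤ a → c ≤ b → a + b ≤ pow2 k → h k a + h k b + c ≤ h k (a + b)

symmetrize : ∀ k → OrderedSuperadditive k → Superadditive k
symmetrize k ordered a b c c≤a c≤b bound with a ≤? b
... | yes a≤b = ≤-trans (+-monoʳ-≤ (h k a + h k b) c≤a) (ordered a b a≤b bound)
... | no  a≰b =
  subst₂ (λ u v → u + c ≤ h k v) (+-comm (h k b) (h k a)) (+-comm b a)
    (≤-trans (+-monoʳ-≤ (h k b + h k a) c≤b)
      (ordered b a (≰⇒≥ a≰b) (subst (_≤ pow2 k) (+-comm a b) bound)))

-- Each case writes h (k+1) in terms of h k at the
-- halves and adds two instances of the hypothesis at level k.
module SuperadditiveStep (k : ℕ) (IH : Superadditive k) where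

  H : ℕ → ℕ
  H = h k

  Claim : ℕ → ℕ → Set
  Claim a b = a ≤ b → a + b ≤ pow2 (suc k) → h (suc k) a + h (suc k) b + a ≤ h (suc k) (a + b)

  IH-suc : ∀ x y → x ≤ y → suc (x + y) ≤ pow2 k → H x + H (suc y) + x ≤ H (suc (x + y))
  IH-suc x y x≤y bound = subst (λ t → H x + H (suc y) + x ≤ H t) (+-suc x y)
    (IH x (suc y) x ≤-refl (m≤n⇒m≤1+n x≤y) (subst (_≤ pow2 k) (sym (+-suc x y)) bound))

  even-even : ∀ x y → Claim (double x) (double y)
  even-even x y a≤b bound =
    add-≤ (x + y) lhs (IH x y x ≤-refl x≤y sum≤) (IH x y x ≤-refl x≤y sum≤) rhs
    where
    x≤y : x ≤ y
    x≤y = double-≤⁻ a≤b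
    sum≤ : x + y ≤ pow2 k
    sum≤ = double-≤⁻ (subst (_≤ pow2 (suc k)) (double-+ x y) bound)
    lhs : h (suc k) (double x) + h (suc k) (double y) + double x ≡ H x + H y + x + (H x + H y + x) + (x + y)
    lhs rewrite h-even k x | h-even k y | double≡+ x = arrange (H x) (H y) x y
      where
      arrange : ∀ hx hy x y → hx + hx + x + (hy + hy + y) + (x + x) ≡ hx + hy + x + (hx + hy + x) + (x + y)
      arrange = solve-∀
    rhs : H (x + y) + H (x + y) + (x + y) ≡ h (suc k) (double x + double y)
    rhs = sym (trans (cong (h (suc k)) (double-+ x y)) (h-even k (x + y)))

  even-odd : ∀ x y → Claim (double x) (suc (double y))
  even-odd x y a≤b bound =
    add-≤ (x + y) lhs (IH-suc x y x≤y sum<) (IH x y x ≤-refl x≤y (<⇒≤ sum<)) rhs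
    where
    x≤y : x ≤ y
    x≤y = double-≤-suc⁻ a≤b
    sum≡ : double x + suc (double y) ≡ suc (double (x + y))
    sum≡ = trans (+-suc (double x) (double y)) (cong suc (double-+ x y))
    sum< : x + y < pow2 k
    sum< = suc-double-≤⁻ (subst (_≤ pow2 (suc k)) sum≡ bound)
    lhs : h (suc k) (double x) + h (suc k) (suc (double y)) + double x ≡ H x + H (suc y) + x + (H x + H y + x) + (x + y)
    lhs rewrite h-even k x | h-odd k y | double≡+ x = arrange (H x) (H y) (H (suc y)) x y
      where
      arrange : ∀ hx hy hsy x y → hx + hx + x + (hsy + hy + y) + (x + x) ≡ hx + hsy + x + (hx + hy + x) + (x + y)
      arrange = solve-∀
    rhs : H (suc (x + y)) + H (x + y) + (x + y) ≡ h (suc k) (double x + suc (double y))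
    rhs = sym (trans (cong (h (suc k)) sum≡) (h-odd k (x + y)))

  odd-even : ∀ x y → Claim (suc (double x)) (double y)
  odd-even x y a≤b bound =
    add-≤ (x + y) lhs (IH (suc x) y (suc x) ≤-refl x<y sum<) (IH x y x ≤-refl (<⇒≤ x<y) (<⇒≤ sum<)) rhs
    where
    x<y : x < y
    x<y = suc-double-≤⁻ a≤b
    sum≡ : suc (double x) + double y ≡ suc (double (x + y))
    sum≡ = cong suc (double-+ x y)
    sum< : x + y < pow2 k
    sum< = suc-double-≤⁻ (subst (_≤ pow2 (suc k)) sum≡ bound)
    lhs : h (suc k) (suc (double x)) + h (suc k) (double y) + suc (double x) ≡ H (suc x) + H y + suc x + (H x + H y + x) + (x + y)
    lhs rewrite h-odd k x | h-even k y | double≡+ x = arrange (H x) (H (suc x)) (H y) x y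
      where
      arrange : ∀ hx hsx hy x y → hsx + hx + x + (hy + hy + y) + suc (x + x) ≡ hsx + hy + suc x + (hx + hy + x) + (x + y)
      arrange = solve-∀
    rhs : H (suc (x + y)) + H (x + y) + (x + y) ≡ h (suc k) (suc (double x) + double y)
    rhs = sym (trans (cong (h (suc k)) sum≡) (h-odd k (x + y)))

  odd-odd : ∀ x y → Claim (suc (double x)) (suc (double y))
  odd-odd x y a≤b bound =
    add-≤ (suc (x + y)) lhs (IH-suc x y x≤y sum<) (IH (suc x) y x (n≤1+n x) x≤y sum<) rhs
    where
    x≤y : x ≤ y
    x≤y = double-≤⁻ (≤-pred a≤b)
    sum≡ : suc (double x) + suc (double y) ≡ double (suc (x + y))
    sum≡ = cong suc (trans (+-suc (double x) (double y)) (cong suc (double-+ x y)))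
    sum< : x + y < pow2 k
    sum< = double-≤⁻ (subst (_≤ pow2 (suc k)) sum≡ bound)
    lhs : h (suc k) (suc (double x)) + h (suc k) (suc (double y)) + suc (double x) ≡ H x + H (suc y) + x + (H (suc x) + H y + x) + suc (x + y)
    lhs rewrite h-odd k x | h-odd k y | double≡+ x = arrange (H x) (H (suc x)) (H y) (H (suc y)) x y
      where
      arrange : ∀ hx hsx hy hsy x y → hsx + hx + x + (hsy + hy + y) + suc (x + x) ≡ hx + hsy + x + (hsx + hy + x) + suc (x + y)
      arrange = solve-∀
    rhs : H (suc (x + y)) + H (suc (x + y)) + suc (x + y) ≡ h (suc k) (suc (double x) + suc (double y))
    rhs = sym (trans (cong (h (suc k)) sum≡) (h-even k (suc (x + y))))

  step : ∀ {a b} → Parity a → Parity b → Claim a b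
  step (even x) (even y) = even-even x y
  step (even x) (odd y)  = even-odd x y
  step (odd x)  (even y) = odd-even x y
  step (odd x)  (odd y)  = odd-odd x y

-- Induction on k; at k = 0 the only admissible pair with a ≤ b has a = 0.
ordered-superadditive : ∀ k → OrderedSuperadditive k
ordered-superadditive zero    zero    b       _ _           = z≤n
ordered-superadditive zero    (suc a) (suc b) _ (s≤s bound) = ⊥-elim (n≮0 (subst (_≤ 0) (+-suc a b) bound))
ordered-superadditive (suc k) a       b                     =
  SuperadditiveStep.step k (symmetrize k (ordered-superadditive k)) (parity a) (parity b)

superadditive : ∀ k → Superadditive k
superadditive k = symmetrize k (ordered-superadditive k)

wsum : ∀ {A : Set} → (A → Bool) → (A → ℕ) → List A → ℕ
wsum q w []       = 0
wsum q w (x ∷ xs) = (if q x then w x else 0) + wsum q w xs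

count : ∀ {A : Set} → (A → Bool) → List A → ℕ
count q = wsum q (λ _ → 1)

sum-filter≡wsum : ∀ {A : Set} (q : A → Bool) (w : A → ℕ) L →
                  sum (map w (filter (λ x → q x Bool.≟ true) L)) ≡ wsum q w L
sum-filter≡wsum q w [] = refl
sum-filter≡wsum q w (x ∷ L) with q x
... | true  = cong (w x +_) (sum-filter≡wsum q w L)
... | false = sum-filter≡wsum q w L

length-filter≡count : ∀ {A : Set} (q : A → Bool) L → length (filter (λ x → q x Bool.≟ true) L) ≡ count q L
length-filter≡count q [] = refl
length-filter≡count q (x ∷ L) with q x
... | true  = cong suc (length-filter≡count q L)
... | false = length-filter≡count q L

wsum-cong : ∀ {A : Set} {q q′ : A → Bool} {w w′ : A → ℕ} →
            (∀ x → q x ≡ q′ x) → (∀ x → w x ≡ w′ x) → ∀ L → wsum q w L ≡ wsum q′ w′ L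
wsum-cong eq ew [] = refl
wsum-cong eq ew (x ∷ L) rewrite eq x | ew x = cong (_ +_) (wsum-cong eq ew L)

wsum-map : ∀ {A B : Set} (q : B → Bool) (w : B → ℕ) (f : A → B) L →
           wsum q w (map f L) ≡ wsum (q ∘ f) (w ∘ f) L
wsum-map q w f []      = refl
wsum-map q w f (x ∷ L) = cong (_ +_) (wsum-map q w f L)

wsum-suc : ∀ {A : Set} (q : A → Bool) (w : A → ℕ) L → wsum q (λ x → suc (w x)) L ≡ wsum q w L + count q L
wsum-suc q w [] = refl
wsum-suc q w (x ∷ L) with q x
... | true  = trans (cong (λ t → suc (w x + t)) (wsum-suc q w L))
                    (trans (cong suc (sym (+-assoc (w x) _ _))) (sym (+-suc (w x + wsum q w L) (count q L))))
... | false = wsum-suc q w L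

count-complement : ∀ {A : Set} (p : A → Bool) L → count p L + count (not ∘ p) L ≡ length L
count-complement p [] = refl
count-complement p (x ∷ L) with p x
... | true  = cong suc (count-complement p L)
... | false = trans (+-suc _ _) (cong suc (count-complement p L))

count≤length : ∀ {A : Set} (p : A → Bool) L → count p L ≤ length L
count≤length p L = subst (count p L ≤_) (count-complement p L) (m≤m+n _ _)

indicator : Bool → ℕ
indicator b = if b then 1 else 0

indicator-≤-∨ : ∀ a b c → (a ≡ true → (b ∨ c) ≡ true) → indicator a ≤ indicator b + indicator c
indicator-≤-∨ false b     c     _   = z≤n
indicator-≤-∨ true  true  c     _   = s≤s z≤n
indicator-≤-∨ true  false true  _   = s≤s z≤n
indicator-≤-∨ true  false false imp with () ← imp refl

count-≤-∨ : ∀ {A : Set} {p q r : A → Bool} → (∀ x → p x ≡ true → (q x ∨ r x) ≡ true) →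
            ∀ L → count p L ≤ count q L + count r L
count-≤-∨ p⇒q∨r [] = z≤n
count-≤-∨ {p = p} {q} {r} p⇒q∨r (x ∷ L) =
  ≤-trans (+-mono-≤ (indicator-≤-∨ (p x) (q x) (r x) (p⇒q∨r x)) (count-≤-∨ p⇒q∨r L))
          (≤-reflexive (interchange (indicator (q x)) (indicator (r x)) (count q L) (count r L)))
  where
  interchange : ∀ a b c d → a + b + (c + d) ≡ a + c + (b + d)
  interchange = solve-∀

-- Boolean equality test of subsets; membership x ∈F? 𝓐 unfolds to a
-- disjunction of these tests.
same : ∀ {n} → Subset n → Subset n → Bool
same s t = does (Vec.≡-dec _≟B_ s t)

shiftIn : Bool → ℕ → ℕ
shiftIn false u = double u
shiftIn true  u = suc (double u)

shiftIn-suc : ∀ b u → shiftIn b (suc u) ≡ suc (suc (shiftIn b u))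
shiftIn-suc false u = refl
shiftIn-suc true  u = refl

value : ∀ {k} → Subset k → ℕ
value []      = 0
value (b ∷ s) = shiftIn b (value s)

value<pow2 : ∀ {k} (s : Subset k) → value s < pow2 k
value<pow2 []          = s≤s z≤n
value<pow2 (false ∷ s) = ≤-trans (n≤1+n _) (double-mono (value<pow2 s))
value<pow2 (true  ∷ s) = double-mono (value<pow2 s)

shiftIn-≡ᵇ : ∀ a b u v → (shiftIn a u ≡ᵇ shiftIn b v) ≡ (does (a ≟B b) ∧ (u ≡ᵇ v))
shiftIn-≡ᵇ a b (suc u) (suc v) rewrite shiftIn-suc a u | shiftIn-suc b v = shiftIn-≡ᵇ a b u v
shiftIn-≡ᵇ false false zero zero    = refl
shiftIn-≡ᵇ false true  zero zero    = refl
shiftIn-≡ᵇ true  false zero zero    = refl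
shiftIn-≡ᵇ true  true  zero zero    = refl
shiftIn-≡ᵇ false false zero (suc v) = refl
shiftIn-≡ᵇ false true  zero (suc v) = refl
shiftIn-≡ᵇ true  false zero (suc v) = refl
shiftIn-≡ᵇ true  true  zero (suc v) = refl
shiftIn-≡ᵇ false false (suc u) zero = refl
shiftIn-≡ᵇ false true  (suc u) zero = refl
shiftIn-≡ᵇ true  false (suc u) zero = refl
shiftIn-≡ᵇ true  true  (suc u) zero = refl

shiftIn-<ᵇ : ∀ a b u v → (shiftIn a u <ᵇ shiftIn b v) ≡ ((u <ᵇ v) ∨ ((u ≡ᵇ v) ∧ (not a ∧ b)))
shiftIn-<ᵇ a b (suc u) (suc v) rewrite shiftIn-suc a u | shiftIn-suc b v = shiftIn-<ᵇ a b u v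
shiftIn-<ᵇ false false zero zero    = refl
shiftIn-<ᵇ false true  zero zero    = refl
shiftIn-<ᵇ true  false zero zero    = refl
shiftIn-<ᵇ true  true  zero zero    = refl
shiftIn-<ᵇ false false zero (suc v) = refl
shiftIn-<ᵇ false true  zero (suc v) = refl
shiftIn-<ᵇ true  false zero (suc v) = refl
shiftIn-<ᵇ true  true  zero (suc v) = refl
shiftIn-<ᵇ false false (suc u) zero = refl
shiftIn-<ᵇ false true  (suc u) zero = refl
shiftIn-<ᵇ true  false (suc u) zero = refl
shiftIn-<ᵇ true  true  (suc u) zero = refl

same-value : ∀ {k} (s t : Subset k) → same s t ≡ (value s ≡ᵇ value t)
same-value []      []      = refl
same-value (a ∷ s) (b ∷ t) = trans (cong (does (a ≟B b) ∧_) (same-value s t)) (sym (shiftIn-≡ᵇ a b (value s) (value t)))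

colex-value : ∀ {k} (s t : Subset k) → (s <colex t) ≡ (value s <ᵇ value t)
colex-value []      []      = refl
colex-value (a ∷ s) (b ∷ t) =
  trans (cong₂ (λ x y → x ∨ (y ∧ (not a ∧ b))) (colex-value s t) (same-value s t))
        (sym (shiftIn-<ᵇ a b (value s) (value t)))

double-<ᵇ : ∀ v m → (double v <ᵇ m) ≡ (v <ᵇ ⌈ m /2⌉)
double-<ᵇ zero    zero          = refl
double-<ᵇ zero    (suc m)       = refl
double-<ᵇ (suc v) zero          = refl
double-<ᵇ (suc v) (suc zero)    = refl
double-<ᵇ (suc v) (suc (suc m)) = double-<ᵇ v m

suc-double-<ᵇ : ∀ v m → (suc (double v) <ᵇ m) ≡ (v <ᵇ ⌊ m /2⌋)
suc-double-<ᵇ zero    zero          = refl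
suc-double-<ᵇ zero    (suc zero)    = refl
suc-double-<ᵇ zero    (suc (suc m)) = refl
suc-double-<ᵇ (suc v) zero          = refl
suc-double-<ᵇ (suc v) (suc zero)    = refl
suc-double-<ᵇ (suc v) (suc (suc m)) = suc-double-<ᵇ v m

wsum-allSubsets : ∀ {k} (q : Subset (suc k) → Bool) (w : Subset (suc k) → ℕ) →
  wsum q w (allSubsets (suc k)) ≡
  wsum (q ∘ (false ∷_)) (w ∘ (false ∷_)) (allSubsets k) + wsum (q ∘ (true ∷_)) (w ∘ (true ∷_)) (allSubsets k)
wsum-allSubsets {k} q w = go (allSubsets k)
  where
  go : ∀ L → wsum q w (concatMap (λ s → (false ∷ s) ∷ (true ∷ s) ∷ []) L) ≡
             wsum (q ∘ (false ∷_)) (w ∘ (false ∷_)) L + wsum (q ∘ (true ∷_)) (w ∘ (true ∷_)) L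
  go []      = refl
  go (s ∷ L) rewrite go L = arrange (if q (false ∷ s) then w (false ∷ s) else 0) (if q (true ∷ s) then w (true ∷ s) else 0) _ _
    where
    arrange : ∀ a b c d → a + (b + (c + d)) ≡ a + c + (b + d)
    arrange = solve-∀

countBelow : ℕ → ℕ → ℕ
countBelow k m = count (λ s → value s <ᵇ m) (allSubsets k)

weightBelow : ℕ → ℕ → ℕ
weightBelow k m = wsum (λ s → value s <ᵇ m) ∣_∣ (allSubsets k)

wsum-below-suc : ∀ k m (w : Subset (suc k) → ℕ) →
  wsum (λ s → value s <ᵇ m) w (allSubsets (suc k)) ≡
  wsum (λ s → value s <ᵇ ⌈ m /2⌉) (w ∘ (false ∷_)) (allSubsets k) + wsum (λ s → value s <ᵇ ⌊ m /2⌋) (w ∘ (true ∷_)) (allSubsets k)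
wsum-below-suc k m w =
  trans (wsum-allSubsets (λ s → value s <ᵇ m) w)
        (cong₂ _+_ (wsum-cong (λ s → double-<ᵇ (value s) m) (λ _ → refl) (allSubsets k))
                   (wsum-cong (λ s → suc-double-<ᵇ (value s) m) (λ _ → refl) (allSubsets k)))

countBelow≡ : ∀ k m → m ≤ pow2 k → countBelow k m ≡ m
countBelow≡ zero    zero       _             = refl
countBelow≡ zero    (suc zero) _             = refl
countBelow≡ zero    (suc (suc m)) (s≤s ())
countBelow≡ (suc k) m          m≤2^k+1 = begin
  countBelow (suc k) m                            ≡⟨ wsum-below-suc k m (λ _ → 1) ⟩
  countBelow k ⌈ m /2⌉ + countBelow k ⌊ m /2⌋      ≡⟨ cong₂ _+_ (countBelow≡ k ⌈ m /2⌉ (⌈/2⌉-bound m≤2^k+1))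
                                                                (countBelow≡ k ⌊ m /2⌋ (⌊/2⌋-bound m≤2^k+1)) ⟩
  ⌈ m /2⌉ + ⌊ m /2⌋                                ≡⟨ +-comm ⌈ m /2⌉ ⌊ m /2⌋ ⟩
  ⌊ m /2⌋ + ⌈ m /2⌉                                ≡⟨ ⌊n/2⌋+⌈n/2⌉≡n m ⟩
  m                                                ∎
  where open ≡-Reasoning

weightBelow≡h : ∀ k m → m ≤ pow2 k → weightBelow k m ≡ h k m
weightBelow≡h zero    zero    _             = refl
weightBelow≡h zero    (suc m) _             = refl
weightBelow≡h (suc k) m       m≤2^k+1 = begin
  weightBelow (suc k) m
    ≡⟨ wsum-below-suc k m ∣_∣ ⟩
  weightBelow k ⌈ m /2⌉ + wsum (λ s → value s <ᵇ ⌊ m /2⌋) (λ s → suc ∣ s ∣) (allSubsets k)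
    ≡⟨ cong (weightBelow k ⌈ m /2⌉ +_) (wsum-suc (λ s → value s <ᵇ ⌊ m /2⌋) ∣_∣ (allSubsets k)) ⟩
  weightBelow k ⌈ m /2⌉ + (weightBelow k ⌊ m /2⌋ + countBelow k ⌊ m /2⌋)
    ≡⟨ sym (+-assoc (weightBelow k ⌈ m /2⌉) _ _) ⟩
  weightBelow k ⌈ m /2⌉ + weightBelow k ⌊ m /2⌋ + countBelow k ⌊ m /2⌋
    ≡⟨ cong₂ (λ x y → x + y + countBelow k ⌊ m /2⌋) (weightBelow≡h k ⌈ m /2⌉ ⌈m/2⌉≤) (weightBelow≡h k ⌊ m /2⌋ ⌊m/2⌋≤) ⟩
  h k ⌈ m /2⌉ + h k ⌊ m /2⌋ + countBelow k ⌊ m /2⌋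
    ≡⟨ cong (h k ⌈ m /2⌉ + h k ⌊ m /2⌋ +_) (countBelow≡ k ⌊ m /2⌋ ⌊m/2⌋≤) ⟩
  h (suc k) m ∎
  where
  open ≡-Reasoning
  ⌈m/2⌉≤ : ⌈ m /2⌉ ≤ pow2 k
  ⌈m/2⌉≤ = ⌈/2⌉-bound m≤2^k+1
  ⌊m/2⌋≤ : ⌊ m /2⌋ ≤ pow2 k
  ⌊m/2⌋≤ = ⌊/2⌋-bound m≤2^k+1

colexRank≡value : ∀ {k} (A : Subset k) → colexRank A ≡ value A
colexRank≡value {k} A = begin
  colexRank A                                   ≡⟨ length-filter≡count (_<colex A) (allSubsets k) ⟩
  count (_<colex A) (allSubsets k)              ≡⟨ wsum-cong (λ C → colex-value C A) (λ _ → refl) (allSubsets k) ⟩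
  countBelow k (value A)                        ≡⟨ countBelow≡ k (value A) (<⇒≤ (value<pow2 A)) ⟩
  value A                                       ∎
  where open ≡-Reasoning

‖I‖≡h : ∀ m → ‖ I m ‖ ≡ h m m
‖I‖≡h m = begin
  ‖ I m ‖                                                ≡⟨ sum-filter≡wsum (λ A → colexRank A <ᵇ m) ∣_∣ (allSubsets m) ⟩
  wsum (λ A → colexRank A <ᵇ m) ∣_∣ (allSubsets m)        ≡⟨ wsum-cong (λ A → cong (_<ᵇ m) (colexRank≡value A)) (λ _ → refl) (allSubsets m) ⟩
  weightBelow m m                                        ≡⟨ weightBelow≡h m m (n≤pow2n m) ⟩
  h m m                                                  ∎
  where open ≡-Reasoning

count-same-absent : ∀ {n} (y : Subset n) L → All (λ z → ¬ y ≡ z) L → count (λ s → same s y) L ≡ 0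
count-same-absent y [] [] = refl
count-same-absent y (z ∷ L) (y≢z ∷ y∉L) with Vec.≡-dec _≟B_ z y
... | yes refl = ⊥-elim (y≢z refl)
... | no _     = count-same-absent y L y∉L

count-same-≤1 : ∀ {n} (y : Subset n) L → Unique L → count (λ s → same s y) L ≤ 1
count-same-≤1 y [] [] = z≤n
count-same-≤1 y (x ∷ L) (x∉L ∷ unique) with Vec.≡-dec _≟B_ x y
... | yes refl = s≤s (≤-reflexive (count-same-absent x L x∉L))
... | no _     = count-same-≤1 y L unique

count-∈-≤ : ∀ {n} (L : Family n) → Unique L → ∀ 𝓐 → count (_∈F? 𝓐) L ≤ length 𝓐
count-∈-≤ L unique [] = ≤-reflexive (none L)
  where
  none : ∀ L → count (_∈F? []) L ≡ 0
  none []      = refl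
  none (x ∷ L) = none L
count-∈-≤ L unique (y ∷ 𝓐) =
  ≤-trans (count-≤-∨ (λ _ member → member) L)
          (+-mono-≤ (count-same-≤1 y L unique) (count-∈-≤ L unique 𝓐))

fiber : ∀ {n} → Bool → Family (suc n) → Family n
fiber b []            = []
fiber b ((c ∷ s) ∷ 𝓐) = if does (b ≟B c) then s ∷ fiber b 𝓐 else fiber b 𝓐

∈F?-fiber : ∀ {n} b (s : Subset n) 𝓐 → ((b ∷ s) ∈F? 𝓐) ≡ (s ∈F? fiber b 𝓐)
∈F?-fiber b     s []                 = refl
∈F?-fiber false s ((false ∷ t) ∷ 𝓐) = cong (same s t ∨_) (∈F?-fiber false s 𝓐)
∈F?-fiber false s ((true  ∷ t) ∷ 𝓐) = ∈F?-fiber false s 𝓐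
∈F?-fiber true  s ((false ∷ t) ∷ 𝓐) = ∈F?-fiber true s 𝓐
∈F?-fiber true  s ((true  ∷ t) ∷ 𝓐) = cong (same s t ∨_) (∈F?-fiber true s 𝓐)

fiber-All : ∀ {n} {P : Subset (suc n) → Set} b 𝓐 → All P 𝓐 → All (λ s → P (b ∷ s)) (fiber b 𝓐)
fiber-All b     []                 []         = []
fiber-All false ((false ∷ t) ∷ 𝓐) (pt ∷ all) = pt ∷ fiber-All false 𝓐 all
fiber-All false ((true  ∷ t) ∷ 𝓐) (pt ∷ all) = fiber-All false 𝓐 all
fiber-All true  ((false ∷ t) ∷ 𝓐) (pt ∷ all) = fiber-All true 𝓐 all
fiber-All true  ((true  ∷ t) ∷ 𝓐) (pt ∷ all) = pt ∷ fiber-All true 𝓐 all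

drop-head : ∀ {n} c (t : Subset n) 𝓐 → All (λ z → ¬ (c ∷ t) ≡ z) 𝓐 → All (λ s → ¬ t ≡ s) (fiber c 𝓐)
drop-head c t 𝓐 c∷t∉𝓐 = All.map (λ c∷t≢c∷s t≡s → c∷t≢c∷s (cong (c ∷_) t≡s)) (fiber-All c 𝓐 c∷t∉𝓐)

fiber-unique : ∀ {n} b (𝓐 : Family (suc n)) → Unique 𝓐 → Unique (fiber b 𝓐)
fiber-unique b     []                 []            = []
fiber-unique false ((false ∷ t) ∷ 𝓐) (t∉𝓐 ∷ unique) = drop-head false t 𝓐 t∉𝓐 ∷ fiber-unique false 𝓐 unique
fiber-unique false ((true  ∷ t) ∷ 𝓐) (t∉𝓐 ∷ unique) = fiber-unique false 𝓐 unique
fiber-unique true  ((false ∷ t) ∷ 𝓐) (t∉𝓐 ∷ unique) = fiber-unique true 𝓐 unique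
fiber-unique true  ((true  ∷ t) ∷ 𝓐) (t∉𝓐 ∷ unique) = drop-head true t 𝓐 t∉𝓐 ∷ fiber-unique true 𝓐 unique

length-fibers : ∀ {n} (𝓛 : Family (suc n)) → length 𝓛 ≡ length (fiber false 𝓛) + length (fiber true 𝓛)
length-fibers []                 = refl
length-fibers ((false ∷ s) ∷ 𝓛) = cong suc (length-fibers 𝓛)
length-fibers ((true  ∷ s) ∷ 𝓛) = trans (cong suc (length-fibers 𝓛)) (sym (+-suc _ _))

-- Each member of fiber true 𝓛 lost the element 1.
norm-fibers : ∀ {n} (𝓛 : Family (suc n)) →
              ‖ 𝓛 ‖ ≡ ‖ fiber false 𝓛 ‖ + ‖ fiber true 𝓛 ‖ + length (fiber true 𝓛)
norm-fibers [] = refl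
norm-fibers ((false ∷ s) ∷ 𝓛) rewrite norm-fibers 𝓛 =
  arrange ∣ s ∣ ‖ fiber false 𝓛 ‖ ‖ fiber true 𝓛 ‖ (length (fiber true 𝓛))
  where
  arrange : ∀ a b c d → a + (b + c + d) ≡ a + b + c + d
  arrange = solve-∀
norm-fibers ((true ∷ s) ∷ 𝓛) rewrite norm-fibers 𝓛 =
  arrange ∣ s ∣ ‖ fiber false 𝓛 ‖ ‖ fiber true 𝓛 ‖ (length (fiber true 𝓛))
  where
  arrange : ∀ a b c d → suc (a + (b + c + d)) ≡ b + (a + c) + suc d
  arrange = solve-∀

-- For B = b ∷ s:  removing element 1 (if present) gives false ∷ s, which lies
-- in 𝓐 iff s ∈ fiber false 𝓐; removing element j+1 gives b ∷ (s - j), which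
-- lies in 𝓐 iff s - j ∈ fiber b 𝓐.
δ-missing-∷ : ∀ {n} (𝓐 : Family (suc n)) b (s : Subset n) →
              δ-missing 𝓐 (b ∷ s) ≡ indicator (b ∧ not (s ∈F? fiber false 𝓐)) + δ-missing (fiber b 𝓐) s
δ-missing-∷ {n} 𝓐 b s = begin
  δ-missing 𝓐 (b ∷ s)
    ≡⟨ length-filter≡count missing (allFin (suc n)) ⟩
  indicator (missing Fin.zero) + count missing (tabulate Fin.suc)
    ≡⟨ cong₂ _+_ (cong (λ B → indicator (b ∧ not B)) missing-1) missing-rest ⟩
  indicator (b ∧ not (s ∈F? fiber false 𝓐)) + count missingInFiber (allFin n)
    ≡⟨ cong (indicator (b ∧ not (s ∈F? fiber false 𝓐)) +_) (sym (length-filter≡count missingInFiber (allFin n))) ⟩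
  indicator (b ∧ not (s ∈F? fiber false 𝓐)) + δ-missing (fiber b 𝓐) s ∎
  where
  open ≡-Reasoning
  missing : Fin (suc n) → Bool
  missing i = lookup (b ∷ s) i ∧ not (((b ∷ s) - i) ∈F? 𝓐)
  missingInFiber : Fin n → Bool
  missingInFiber j = lookup s j ∧ not ((s - j) ∈F? fiber b 𝓐)
  missing-1 : ((b ∷ s) - Fin.zero) ∈F? 𝓐 ≡ s ∈F? fiber false 𝓐
  missing-1 = trans (cong (λ t → (false ∷ t) ∈F? 𝓐) (p─⊥≡p s)) (∈F?-fiber false s 𝓐)
  missing-rest : count missing (tabulate Fin.suc) ≡ count missingInFiber (allFin n)
  missing-rest = begin
    count missing (tabulate Fin.suc)          ≡⟨ cong (count missing) (sym (map-tabulate id Fin.suc)) ⟩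
    count missing (map Fin.suc (allFin n))    ≡⟨ wsum-map missing (λ _ → 1) Fin.suc (allFin n) ⟩
    count (missing ∘ Fin.suc) (allFin n)      ≡⟨ wsum-cong (λ j → cong (λ B → lookup s j ∧ not B) (∈F?-fiber b (s - j) 𝓐)) (λ _ → refl) (allFin n) ⟩
    count missingInFiber (allFin n)           ∎

-- deficiencyIn 𝓐 𝓛 = Σ_{B ∈ 𝓛} |δB ∖ 𝓐|, so that def 𝓑 = deficiencyIn 𝓑 𝓑.
deficiencyIn : ∀ {n} → Family n → Family n → ℕ
deficiencyIn 𝓐 𝓛 = sum (map (δ-missing 𝓐) 𝓛)

deficiency-fibers : ∀ {n} (𝓐 𝓛 : Family (suc n)) →
  deficiencyIn 𝓐 𝓛 ≡ deficiencyIn (fiber false 𝓐) (fiber false 𝓛) + deficiencyIn (fiber true 𝓐) (fiber true 𝓛)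
                     + count (not ∘ (_∈F? fiber false 𝓐)) (fiber true 𝓛)
deficiency-fibers 𝓐 [] = refl
deficiency-fibers 𝓐 ((false ∷ s) ∷ 𝓛) rewrite δ-missing-∷ 𝓐 false s | deficiency-fibers 𝓐 𝓛 =
  arrange (δ-missing (fiber false 𝓐) s) (deficiencyIn (fiber false 𝓐) (fiber false 𝓛))
          (deficiencyIn (fiber true 𝓐) (fiber true 𝓛)) (count (not ∘ (_∈F? fiber false 𝓐)) (fiber true 𝓛))
  where
  arrange : ∀ a b c d → a + (b + c + d) ≡ a + b + c + d
  arrange = solve-∀
deficiency-fibers 𝓐 ((true ∷ s) ∷ 𝓛) rewrite δ-missing-∷ 𝓐 true s | deficiency-fibers 𝓐 𝓛 =
  arrange (indicator (not (s ∈F? fiber false 𝓐))) (δ-missing (fiber true 𝓐) s)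
          (deficiencyIn (fiber false 𝓐) (fiber false 𝓛)) (deficiencyIn (fiber true 𝓐) (fiber true 𝓛))
          (count (not ∘ (_∈F? fiber false 𝓐)) (fiber true 𝓛))
  where
  arrange : ∀ a b c d e → a + b + (c + d + e) ≡ c + (b + d) + (a + e)
  arrange = solve-∀

norm-family-0 : (𝓑 : Family 0) → ‖ 𝓑 ‖ ≡ 0
norm-family-0 []       = refl
norm-family-0 ([] ∷ 𝓑) = norm-family-0 𝓑

norm-bound : ∀ n (𝓑 : Family n) → Unique 𝓑 → ∀ k → length 𝓑 ≤ pow2 k → ‖ 𝓑 ‖ ≤ h k (length 𝓑) + def 𝓑
norm-bound zero    𝓑 _      k _     = subst (_≤ h k (length 𝓑) + def 𝓑) (sym (norm-family-0 𝓑)) z≤n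
norm-bound (suc n) 𝓑 unique k bound = begin
  ‖ 𝓑 ‖                                               ≡⟨ norm-fibers 𝓑 ⟩
  ‖ 𝓑₀ ‖ + ‖ 𝓑₁ ‖ + b                                ≡⟨ cong (‖ 𝓑₀ ‖ + ‖ 𝓑₁ ‖ +_) (sym (count-complement (_∈F? 𝓑₀) 𝓑₁)) ⟩
  ‖ 𝓑₀ ‖ + ‖ 𝓑₁ ‖ + (shared + missing)               ≤⟨ +-monoˡ-≤ (shared + missing) (+-mono-≤ IH₀ IH₁) ⟩
  h k a + def 𝓑₀ + (h k b + def 𝓑₁) + (shared + missing)
                                                     ≡⟨ arrange (h k a) (h k b) (def 𝓑₀) (def 𝓑₁) shared missing ⟩
  h k a + h k b + shared + (def 𝓑₀ + def 𝓑₁ + missing) ≤⟨ +-monoˡ-≤ (def 𝓑₀ + def 𝓑₁ + missing) h-step ⟩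
  h k (a + b) + (def 𝓑₀ + def 𝓑₁ + missing)           ≡⟨ cong₂ _+_ (cong (h k) (sym (length-fibers 𝓑))) (sym (deficiency-fibers 𝓑 𝓑)) ⟩
  h k (length 𝓑) + def 𝓑                              ∎
  where
  open ≤-Reasoning
  𝓑₀ 𝓑₁ : Family n
  𝓑₀ = fiber false 𝓑
  𝓑₁ = fiber true 𝓑
  a b shared missing : ℕ
  a = length 𝓑₀
  b = length 𝓑₁
  shared  = count (_∈F? 𝓑₀) 𝓑₁
  missing = count (not ∘ (_∈F? 𝓑₀)) 𝓑₁
  a+b≤2^k : a + b ≤ pow2 k
  a+b≤2^k = subst (_≤ pow2 k) (length-fibers 𝓑) bound
  IH₀ : ‖ 𝓑₀ ‖ ≤ h k a + def 𝓑₀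
  IH₀ = norm-bound n 𝓑₀ (fiber-unique false 𝓑 unique) k (≤-trans (m≤m+n a b) a+b≤2^k)
  IH₁ : ‖ 𝓑₁ ‖ ≤ h k b + def 𝓑₁
  IH₁ = norm-bound n 𝓑₁ (fiber-unique true 𝓑 unique) k (≤-trans (m≤n+m b a) a+b≤2^k)
  -- the sets in both fibers number at most min(a, b)
  h-step : h k a + h k b + shared ≤ h k (a + b)
  h-step = superadditive k a b shared (count-∈-≤ 𝓑₁ (fiber-unique true 𝓑 unique) 𝓑₀)
                         (count≤length (_∈F? 𝓑₀) 𝓑₁) a+b≤2^k
  arrange : ∀ ha hb da db s m → ha + da + (hb + db) + (s + m) ≡ ha + hb + s + (da + db + m)
  arrange = solve-∀

lemma13 : (n m : ℕ) (𝓑 : Family n) → Unique 𝓑 → length 𝓑 ≡ m → ‖ 𝓑 ‖ ≤ ‖ I m ‖ + def 𝓑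
lemma13 n m 𝓑 unique refl =
  subst (λ t → ‖ 𝓑 ‖ ≤ t + def 𝓑) (sym (‖I‖≡h m)) (norm-bound n 𝓑 unique m (n≤pow2n m))
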